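{- Define polynomials $r_n(x)$ by $\sum_{n\ge 0} r_n(x)y^n=\frac{y}{(1-y)(1+(1-x)y+y^2)}$, and polynomials $q_n(x)$ by $\sum_{n\ge0}q_n(x)z^n=\frac{1}{1-xz+z^2}$ (so $q_n(x)=U_n(x/2)$, where $U_n$ is the Chebyshev polynomial of the second kind). Then $r_1(x+1)=q_0(x)^2$, and for all integers $m>0$, \[ r_{2m}(x+1)=q_{m-1}(x)\big(q_{m-1}(x)+q_m(x)\big),\qquad r_{2m+1}(x+1)=q_m(x)\big(q_{m-1}(x)+q_m(x)\big). \]
   Context: The Chebyshev polynomials of the second kind $U_n(x)$ are defined by $\sum_{n\ge0}U_n(x)z^n=\frac{1}{1-2xz+z^2}$. -}

module Defs where

open import Level using (Level)
open import Data.Nat using (ℕ; zero; suc)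
open import Algebra.Bundles using (CommutativeRing)

-- The polynomials q_n and r_n, evaluated at an element x of an arbitrary
-- commutative ring R.  (An identity holding for every x in every commutative
-- ring is the same as an identity in ℤ[x]: take R = ℤ[x], x = X.)
module Poly {c ℓ : Level} (R : CommutativeRing c ℓ) where
  open CommutativeRing R

  -- Σ q_n z^n = 1 / (1 - x z + z²), i.e. the coefficients satisfy
  -- q_0 = 1, q_1 = x, q_{n+2} = x q_{n+1} - q_n.
  q : ℕ → Carrier → Carrier
  q zero x = 1#
  q (suc zero) x = x
  q (suc (suc n)) x = x * q (suc n) x - q n x

  -- Σ r_n y^n = y / ((1-y)(1+(1-x)y+y²)) = y / (1 - x y + x y² - y³), i.e.
  -- r_0 = 0, r_1 = 1, r_2 = x, r_{n+3} = x r_{n+2} - x r_{n+1} + r_n.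
  r : ℕ → Carrier → Carrier
  r zero x = 0#
  r (suc zero) x = 1#
  r (suc (suc zero)) x = x
  r (suc (suc (suc n))) x = (x * r (suc (suc n)) x - x * r (suc n) x) + r n x

-- For any sequence Q with Q_{k+2} + Q_k = x Q_{k+1}, the interleaved products
-- Q_m (Q_m + Q_{m+1}) and Q_{m+1} (Q_m + Q_{m+1}), m = 0, 1, …, satisfy the recurrence
-- of r at x + 1, whose characteristic polynomial 1 - (x+1)t + (x+1)t² - t³ is
-- (1 - t)(1 - xt + t²).  For Q = (0, q_0, q_1, …) they also share the initial values
-- 0, 1, x + 1 of r, hence they are the values of r at x + 1.
module Submission where

open import Defs
open import Level using (Level)
open import Data.Nat using (ℕ; zero; suc; ⌊_/2⌋; ⌈_/2⌉)
open import Data.Nat.Properties using (*-suc)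
open import Data.Product using (_×_; _,_)
open import Algebra.Bundles using (CommutativeRing)
open import Function using (_∘_)
open import Relation.Binary.PropositionalEquality as ≡ using (_≡_)

module ChebyshevProducts {c ℓ : Level} (R : CommutativeRing c ℓ) where
  open CommutativeRing R
  open Poly R
  open import Algebra.Properties.Group +-group using (//-rightDividesˡ; //-rightDividesʳ)
  open import Algebra.Properties.CommutativeSemigroup +-commutativeSemigroup using (xy∙z≈xz∙y)
  open import Algebra.Solver.Ring.NaturalCoefficients.Default commutativeSemiring
  open import Relation.Binary.Reasoning.Setoid setoid

  x≈y-z⇒x+z≈y : ∀ {x y z} → x ≈ y - z → x + z ≈ y
  x≈y-z⇒x+z≈y {y = y} {z} x≈y-z = trans (+-congʳ x≈y-z) (//-rightDividesˡ z y)

  x+z≈y+w⇒x≈y-z+w : ∀ {x y z w} → x + z ≈ y + w → x ≈ (y - z) + w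
  x+z≈y+w⇒x≈y-z+w {x} {y} {z} {w} x+z≈y+w = begin
    x             ≈⟨ //-rightDividesʳ z x ⟨
    (x + z) - z   ≈⟨ +-congʳ x+z≈y+w ⟩
    (y + w) - z   ≈⟨ xy∙z≈xz∙y y w (- z) ⟩
    (y - z) + w   ∎

  -- The recurrence of r with its negative term moved across, so that instances of it
  -- are semiring identities.
  RRecurrence : Carrier → (ℕ → Carrier) → Set ℓ
  RRecurrence y g = ∀ n → g (suc (suc (suc n))) + y * g (suc n) ≈ y * g (suc (suc n)) + g n

  r-unique : ∀ y (g : ℕ → Carrier) → g 0 ≈ 0# → g 1 ≈ 1# → g 2 ≈ y →
             RRecurrence y g → ∀ n → g n ≈ r n y
  r-unique y g g₀ g₁ g₂ rec = go
    where
    go : ∀ n → g n ≈ r n y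
    go zero = g₀
    go (suc zero) = g₁
    go (suc (suc zero)) = g₂
    go (suc (suc (suc n))) = trans (x+z≈y+w⇒x≈y-z+w (rec n))
      (+-cong (+-cong (*-congˡ (go (suc (suc n)))) (-‿cong (*-congˡ (go (suc n))))) (go n))

  ChebyshevRecurrence : Carrier → (ℕ → Carrier) → Set ℓ
  ChebyshevRecurrence x Q = ∀ n → Q (suc (suc n)) + Q n ≈ x * Q (suc n)

  interleavedProduct : (ℕ → Carrier) → ℕ → Carrier
  interleavedProduct Q n = Q ⌈ n /2⌉ * (Q ⌊ n /2⌋ + Q (suc ⌊ n /2⌋))

  -- Only the terms carrying x need the Chebyshev relation: once x b is traded for c + a
  -- (and x c for d + b), what is left is a semiring identity.
  even-index-step : ∀ {x a b c} → c + a ≈ x * b →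
    c * (b + c) + (x + 1#) * (b * (a + b)) ≈ (x + 1#) * (b * (b + c)) + a * (a + b)
  even-index-step {x} {a} {b} {c} c+a≈xb = begin
    c * (b + c) + (x + 1#) * (b * (a + b))
      ≈⟨ solve 4 (λ x a b c → c :* (b :+ c) :+ (x :+ con 1) :* (b :* (a :+ b))
                           := c :* (b :+ c) :+ (x :* b) :* (a :+ b) :+ b :* (a :+ b)) refl x a b c ⟩
    c * (b + c) + (x * b) * (a + b) + b * (a + b)
      ≈⟨ +-congʳ (+-congˡ (*-congʳ c+a≈xb)) ⟨
    c * (b + c) + (c + a) * (a + b) + b * (a + b)
      ≈⟨ solve 3 (λ a b c → c :* (b :+ c) :+ (c :+ a) :* (a :+ b) :+ b :* (a :+ b)
                         := (c :+ a) :* (b :+ c) :+ b :* (b :+ c) :+ a :* (a :+ b)) refl a b c ⟩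
    (c + a) * (b + c) + b * (b + c) + a * (a + b)
      ≈⟨ +-congʳ (+-congʳ (*-congʳ c+a≈xb)) ⟩
    (x * b) * (b + c) + b * (b + c) + a * (a + b)
      ≈⟨ solve 4 (λ x a b c → (x :* b) :* (b :+ c) :+ b :* (b :+ c) :+ a :* (a :+ b)
                           := (x :+ con 1) :* (b :* (b :+ c)) :+ a :* (a :+ b)) refl x a b c ⟩
    (x + 1#) * (b * (b + c)) + a * (a + b) ∎

  odd-index-step : ∀ {x a b c d} → c + a ≈ x * b → d + b ≈ x * c →
    c * (c + d) + (x + 1#) * (b * (b + c)) ≈ (x + 1#) * (c * (b + c)) + b * (a + b)
  odd-index-step {x} {a} {b} {c} {d} c+a≈xb d+b≈xc = begin
    c * (c + d) + (x + 1#) * (b * (b + c))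
      ≈⟨ solve 4 (λ x b c d → c :* (c :+ d) :+ (x :+ con 1) :* (b :* (b :+ c))
                           := (x :* b) :* b :+ x :* (b :* c) :+ c :* (c :+ d) :+ b :* (b :+ c)) refl x b c d ⟩
    (x * b) * b + x * (b * c) + c * (c + d) + b * (b + c)
      ≈⟨ +-congʳ (+-congʳ (+-congʳ (*-congʳ c+a≈xb))) ⟨
    (c + a) * b + x * (b * c) + c * (c + d) + b * (b + c)
      ≈⟨ solve 5 (λ x a b c d → (c :+ a) :* b :+ x :* (b :* c) :+ c :* (c :+ d) :+ b :* (b :+ c)
                             := (d :+ b) :* c :+ x :* (b :* c) :+ c :* (b :+ c) :+ b :* (a :+ b)) refl x a b c d ⟩
    (d + b) * c + x * (b * c) + c * (b + c) + b * (a + b)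
      ≈⟨ +-congʳ (+-congʳ (+-congʳ (*-congʳ d+b≈xc))) ⟩
    (x * c) * c + x * (b * c) + c * (b + c) + b * (a + b)
      ≈⟨ solve 4 (λ x a b c → (x :* c) :* c :+ x :* (b :* c) :+ c :* (b :+ c) :+ b :* (a :+ b)
                           := (x :+ con 1) :* (c :* (b :+ c)) :+ b :* (a :+ b)) refl x a b c ⟩
    (x + 1#) * (c * (b + c)) + b * (a + b) ∎

  -- interleavedProduct Q (2 + n) is definitionally interleavedProduct (Q ∘ suc) n.
  interleavedProduct-recurrence : ∀ {x Q} → ChebyshevRecurrence x Q →
                                  RRecurrence (x + 1#) (interleavedProduct Q)
  interleavedProduct-recurrence rec zero = even-index-step (rec 0)
  interleavedProduct-recurrence rec (suc zero) = odd-index-step (rec 0) (rec 1)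
  interleavedProduct-recurrence rec (suc (suc n)) = interleavedProduct-recurrence (rec ∘ suc) n

  interleavedProduct-double : ∀ Q m →
    interleavedProduct Q (2 Data.Nat.* m) ≡ Q m * (Q m + Q (suc m))
  interleavedProduct-double Q zero = ≡.refl
  interleavedProduct-double Q (suc m) =
    ≡.trans (≡.cong (interleavedProduct Q) (*-suc 2 m)) (interleavedProduct-double (Q ∘ suc) m)

  interleavedProduct-suc-double : ∀ Q m →
    interleavedProduct Q (suc (2 Data.Nat.* m)) ≡ Q (suc m) * (Q m + Q (suc m))
  interleavedProduct-suc-double Q zero = ≡.refl
  interleavedProduct-suc-double Q (suc m) =
    ≡.trans (≡.cong (interleavedProduct Q ∘ suc) (*-suc 2 m)) (interleavedProduct-suc-double (Q ∘ suc) m)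

  shiftedQ : Carrier → ℕ → Carrier
  shiftedQ x zero = 0#
  shiftedQ x (suc n) = q n x

  shiftedQ-chebyshev : ∀ x → ChebyshevRecurrence x (shiftedQ x)
  shiftedQ-chebyshev x zero = trans (+-identityʳ x) (sym (*-identityʳ x))
  shiftedQ-chebyshev x (suc n) = x≈y-z⇒x+z≈y refl

  r-shift≈interleavedProduct : ∀ x n → r n (x + 1#) ≈ interleavedProduct (shiftedQ x) n
  r-shift≈interleavedProduct x n = sym (r-unique (x + 1#) (interleavedProduct (shiftedQ x))
    (zeroˡ (0# + 1#))
    (trans (*-identityˡ (0# + 1#)) (+-identityˡ 1#))
    (trans (*-identityˡ (1# + x)) (+-comm 1# x))
    (interleavedProduct-recurrence (shiftedQ-chebyshev x)) n)

mainTheorem5 : ∀ {c ℓ : Level} (R : CommutativeRing c ℓ) → let open CommutativeRing R in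
    (∀ x → Poly.r R 1 (x + 1#) ≈ Poly.q R 0 x * Poly.q R 0 x)
    × (∀ (m : ℕ) (x : Carrier) →
        (Poly.r R (2 Data.Nat.* suc m) (x + 1#) ≈ Poly.q R m x * (Poly.q R m x + Poly.q R (suc m) x))
        × (Poly.r R (suc (2 Data.Nat.* suc m)) (x + 1#) ≈ Poly.q R (suc m) x * (Poly.q R m x + Poly.q R (suc m) x)))
mainTheorem5 R = (λ x → sym (*-identityˡ 1#)) , λ m x →
    trans (r-shift≈interleavedProduct x (2 Data.Nat.* suc m))
          (reflexive (interleavedProduct-double (shiftedQ x) (suc m)))
  , trans (r-shift≈interleavedProduct x (suc (2 Data.Nat.* suc m)))
          (reflexive (interleavedProduct-suc-double (shiftedQ x) (suc m)))
  where
  open CommutativeRing R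
  open ChebyshevProducts R
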